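{- Consider peg solitaire on Wiegleb's 45-hole board. Start with a man in every hole except d9. Then there is a legal sequence of moves that ends with a single man at d3, in which the last move is a 9-sweep.
   Context: Wiegleb's board has columns labelled a–i and rows numbered 1–9. Its holes are all holes in columns d, e, f (rows 1–9) together with all holes in rows 4, 5, 6 (columns a–i), 45 holes in total. Peg solitaire rules: each hole is either empty or holds one man. A jump takes a man from a hole X over an orthogonally adjacent occupied hole Y into the empty hole Z immediately beyond Y on the same line; the man at Y is removed. A move is a sequence of one or more consecutive jumps made by the same man. A move with k jumps is called a k-sweep. -}

module Defs where

open import Data.Nat using (ℕ; zero; suc; _+_; _≤ᵇ_)
open import Data.Nat.Properties using (_≟_)
open import Data.Bool using (Bool; true; false; _∧_; _∨_; not; if_then_else_; T)
open import Data.Product using (_×_; _,_; ∃; ∃-syntax)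
open import Data.Sum using (_⊎_)
open import Relation.Nullary.Decidable using (⌊_⌋)
open import Relation.Binary.PropositionalEquality using (_≡_)

-- A position is (column , row).  Columns a,b,…,i are 0,1,…,8;
-- rows are numbered 1,…,9 as on the board.
Pos : Set
Pos = ℕ × ℕ

_==_ : Pos → Pos → Bool
(c , r) == (c' , r') = ⌊ c ≟ c' ⌋ ∧ ⌊ r ≟ r' ⌋

isHole : Pos → Bool
isHole (c , r) =
  ((3 ≤ᵇ c) ∧ (c ≤ᵇ 5) ∧ (1 ≤ᵇ r) ∧ (r ≤ᵇ 9))
  ∨ ((4 ≤ᵇ r) ∧ (r ≤ᵇ 6) ∧ (c ≤ᵇ 8))

Hole : Pos → Set
Hole p = T (isHole p)

d3 d9 : Pos
d3 = (3 , 3)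
d9 = (3 , 9)

-- A board position: which holes hold a man (true = occupied).
Board : Set
Board = Pos → Bool

data Line : Pos → Pos → Pos → Set where
  right : ∀ c r → Line (c , r) (suc c , r) (suc (suc c) , r)
  left  : ∀ c r → Line (suc (suc c) , r) (suc c , r) (c , r)
  up    : ∀ c r → Line (c , r) (c , suc r) (c , suc (suc r))
  down  : ∀ c r → Line (c , suc (suc r)) (c , suc r) (c , r)

afterJump : Board → Pos → Pos → Pos → Board
afterJump b X Y Z p =
  if p == Z then true
  else if (p == X) ∨ (p == Y) then false
  else b p

record Jump (b : Board) (X Y Z : Pos) : Set where
  field
    line  : Line X Y Z
    holeX : Hole X
    holeY : Hole Y
    holeZ : Hole Z
    occX  : b X ≡ true
    occY  : b Y ≡ true
    empZ  : b Z ≡ false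

data Sweep : ℕ → Board → Pos → Pos → Board → Set where
  one  : ∀ {b X Y Z} → Jump b X Y Z → Sweep 1 b X Z (afterJump b X Y Z)
  more : ∀ {k b X Y Z W b'} → Jump b X Y Z →
         Sweep k (afterJump b X Y Z) Z W b' →
         Sweep (suc k) b X W b'

-- a single move: a k-sweep for some k ≥ 1 (k ≥ 1 is forced by Sweep)
Move : Board → Board → Set
Move b b' = ∃[ k ] ∃[ X ] ∃[ Z ] Sweep k b X Z b'

data Moves : Board → Board → Set where
  done : ∀ {b} → Moves b b
  step : ∀ {b b' b''} → Move b b' → Moves b' b'' → Moves b b''

initial : Board
initial p = isHole p ∧ not (p == d9)

SingleManAt : Pos → Board → Set
SingleManAt q b = ∀ p → b p ≡ (p == q)

{-# OPTIONS --safe #-}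
-- The witness is an explicit solution: 32 moves (31 single jumps and one 3-sweep) leave ten
-- men, among them one at d9, which then sweeps d9-f9-f7-d7-d5-d3-d1-f1-f3-d3, taking the
-- other nine. Legality is established by evaluation: each checker returns a move only together
-- with its proof of legality, so `from-just` has the required type exactly when the
-- check succeeds. A board is a function on all of ℕ × ℕ, so being a single man at d3 also
-- constrains the infinitely many points off the board; these stay empty because men only
-- ever land in holes, which leaves a finite check on the 9 × 10 rectangle of columns a–i
-- and rows 0–9.
module Submission where

open import Defs
open import Data.Bool using (true; false; _∧_; if_then_else_; T)
open import Data.Bool.Properties using (T-∧; T-∨; T-≡)
import Data.Bool.Properties as Bool
open import Data.Fin using (Fin; toℕ; fromℕ<)
open import Data.Fin.Properties using (all?; toℕ-fromℕ<)
open import Data.List using (List; []; _∷_)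
open import Data.List.NonEmpty using (List⁺; _∷_; [_]; length)
open import Data.Maybe using (Maybe; just; nothing; _>>=_; from-just)
open import Data.Nat using (ℕ; suc; _≤_; _≤ᵇ_; s≤s)
open import Data.Nat.Properties using (_≟_; ≤ᵇ⇒≤; ≤-trans)
open import Data.Product using (_×_; _,_; proj₁; proj₂; ∃₂; ∃-syntax)
open import Data.Sum using (_⊎_; inj₁; inj₂; [_,_]′)
import Data.Sum as Sum
open import Data.Empty using (⊥-elim)
open import Function using (_∘_; id)
open import Function.Bundles using (Equivalence)
open import Relation.Nullary using (Dec; yes; no; ¬_)
open import Relation.Nullary.Decidable using (⌊_⌋; T?; dec⇒maybe; toWitness; from-yes)
open import Relation.Binary.PropositionalEquality using (_≡_; refl; sym; trans; cong₂; subst)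

private variable
  k : ℕ
  b b′ : Board
  p q X Y Z : Pos

==⇒≡ : ∀ p q → T (p == q) → p ≡ q
==⇒≡ (c , r) (c′ , r′) eq =
  let c≡ , r≡ = Equivalence.to (T-∧ {⌊ c ≟ c′ ⌋}) eq
  in cong₂ _,_ (toWitness c≡) (toWitness r≡)

hole⇒bounded : ∀ {c r} → Hole (c , r) → c ≤ 8 × r ≤ 9
hole⇒bounded {c} {r} h =
  [ vertical , horizontal ]′ (Equivalence.to (T-∨ {x = (3 ≤ᵇ c) ∧ _}) h)
  where
  ∧⁻ : ∀ x {y} → T (x ∧ y) → T x × T y
  ∧⁻ x = Equivalence.to (T-∧ {x})

  vertical : T ((3 ≤ᵇ c) ∧ (c ≤ᵇ 5) ∧ (1 ≤ᵇ r) ∧ (r ≤ᵇ 9)) → c ≤ 8 × r ≤ 9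
  vertical v =
    let _   , v′ = ∧⁻ (3 ≤ᵇ c) v
        c≤5 , v″ = ∧⁻ (c ≤ᵇ 5) v′
        _   , r≤9 = ∧⁻ (1 ≤ᵇ r) v″
    in ≤-trans (≤ᵇ⇒≤ c 5 c≤5) (≤ᵇ⇒≤ 5 8 _) , ≤ᵇ⇒≤ r 9 r≤9

  horizontal : T ((4 ≤ᵇ r) ∧ (r ≤ᵇ 6) ∧ (c ≤ᵇ 8)) → c ≤ 8 × r ≤ 9
  horizontal h =
    let _   , h′ = ∧⁻ (4 ≤ᵇ r) h
        r≤6 , c≤8 = ∧⁻ (r ≤ᵇ 6) h′
    in ≤ᵇ⇒≤ c 8 c≤8 , ≤-trans (≤ᵇ⇒≤ r 6 r≤6) (≤ᵇ⇒≤ 6 9 _)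

Supported : Board → Set
Supported b = ∀ p → T (b p) → Hole p

initial-supported : Supported initial
initial-supported p occ = proj₁ (Equivalence.to (T-∧ {isHole p}) occ)

afterJump-occupied : ∀ b X Y Z p → T (afterJump b X Y Z p) → p ≡ Z ⊎ T (b p)
afterJump-occupied b X Y Z p occ =
  Sum.map₁ (==⇒≡ p Z) (landed-or-untouched (p == Z) _ (b p) occ)
  where
  landed-or-untouched : ∀ z xy v →
                        T (if z then true else if xy then false else v) → T z ⊎ T v
  landed-or-untouched true  _     _ _   = inj₁ _
  landed-or-untouched false false _ occ = inj₂ occ

afterJump-supported : Jump b X Y Z → Supported b → Supported (afterJump b X Y Z)
afterJump-supported {b} {X} {Y} {Z} j sup p occ with afterJump-occupied b X Y Z p occ
... | inj₁ refl = Jump.holeZ j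
... | inj₂ occ′ = sup p occ′

sweep-supported : Sweep k b X Z b′ → Supported b → Supported b′
sweep-supported (one j)    = afterJump-supported j
sweep-supported (more j s) = sweep-supported s ∘ afterJump-supported j

moves-supported : Moves b b′ → Supported b → Supported b′
moves-supported done                      = id
moves-supported (step (_ , _ , _ , s) ms) = moves-supported ms ∘ sweep-supported s

off-board-empty : Supported b → ¬ Hole p → b p ≡ false
off-board-empty {b} {p} sup ¬hole with b p in occ
... | true  = ⊥-elim (¬hole (sup p (Equivalence.from T-≡ occ)))
... | false = refl

off-board-≠ : Hole q → ¬ Hole p → (p == q) ≡ false
off-board-≠ {q} {p} hole ¬hole with p == q in eq
... | true  = ⊥-elim (¬hole (subst Hole (sym (==⇒≡ p q (Equivalence.from T-≡ eq))) hole))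
... | false = refl

SingleManAtInRectangle : Pos → Board → Set
SingleManAtInRectangle q b =
  ∀ (i : Fin 9) (j : Fin 10) → b (toℕ i , toℕ j) ≡ ((toℕ i , toℕ j) == q)

singleManAtInRectangle? : ∀ q b → Dec (SingleManAtInRectangle q b)
singleManAtInRectangle? q b =
  all? λ i → all? λ j → b (toℕ i , toℕ j) Bool.≟ ((toℕ i , toℕ j) == q)

singleManAt-fromRectangle : Supported b → Hole q → SingleManAtInRectangle q b → SingleManAt q b
singleManAt-fromRectangle {b} {q} sup hole check p@(c , r) with T? (isHole p)
... | no ¬hole = trans (off-board-empty sup ¬hole) (sym (off-board-≠ {p = p} hole ¬hole))
... | yes hole-p =
  let c≤8 , r≤9 = hole⇒bounded hole-p
  in subst (λ p → b p ≡ (p == q))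
           (cong₂ _,_ (toℕ-fromℕ< (s≤s c≤8)) (toℕ-fromℕ< (s≤s r≤9)))
           (check (fromℕ< (s≤s c≤8)) (fromℕ< (s≤s r≤9)))

data Dir : Set where
  east west north south : Dir

hop : Dir → (X : Pos) → Maybe (∃₂ (Line X))
hop east  (c , r)           = just (_ , _ , right c r)
hop west  (suc (suc c) , r) = just (_ , _ , left c r)
hop west  _                 = nothing
hop north (c , r)           = just (_ , _ , up c r)
hop south (c , suc (suc r)) = just (_ , _ , down c r)
hop south _                 = nothing

jump? : (b : Board) (X : Pos) → Dir → Maybe (∃₂ (Jump b X))
jump? b X d = do
  Y , Z , line ← hop d X
  holeX ← dec⇒maybe (T? (isHole X))
  holeY ← dec⇒maybe (T? (isHole Y))
  holeZ ← dec⇒maybe (T? (isHole Z))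
  occX ← dec⇒maybe (b X Bool.≟ true)
  occY ← dec⇒maybe (b Y Bool.≟ true)
  empZ ← dec⇒maybe (b Z Bool.≟ false)
  just (Y , Z , record { line = line ; holeX = holeX ; holeY = holeY ; holeZ = holeZ
                       ; occX = occX ; occY = occY ; empZ = empZ })

SweepFrom : ℕ → Board → Pos → Set
SweepFrom k b X = ∃[ Z ] ∃[ b′ ] Sweep k b X Z b′

sweep? : (b : Board) (X : Pos) (ds : List⁺ Dir) → Maybe (SweepFrom (length ds) b X)
sweep? b X (d ∷ ds) = go b X d ds
  where
  go : (b : Board) (X : Pos) (d : Dir) (ds : List Dir) →
       Maybe (SweepFrom (length (d ∷ ds)) b X)
  go b X d [] = do
    _ , Z , j ← jump? b X d
    just (Z , _ , one j)
  go b X d (d′ ∷ ds) = do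
    Y , Z , j ← jump? b X d
    W , b′ , s ← go (afterJump b X Y Z) Z d′ ds
    just (W , b′ , more j s)

moves? : (b : Board) → List (Pos × List⁺ Dir) → Maybe (∃[ b′ ] Moves b b′)
moves? b [] = just (b , done)
moves? b ((X , ds) ∷ ms) = do
  Z , b′ , s ← sweep? b X ds
  b″ , ms′ ← moves? b′ ms
  just (b″ , step (_ , X , Z , s) ms′)

opening : List (Pos × List⁺ Dir)
opening =
  ((5 , 9) , [ west ]) ∷
  ((4 , 7) , [ north ]) ∷
  ((4 , 5) , [ north ]) ∷
  ((6 , 5) , [ west ]) ∷
  ((5 , 7) , [ south ]) ∷
  ((7 , 6) , [ west ]) ∷
  ((4 , 5) , [ east ]) ∷
  ((6 , 4) , [ north ]) ∷
  ((8 , 4) , [ west ]) ∷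
  ((5 , 6) , [ east ]) ∷
  ((5 , 4) , [ east ]) ∷
  ((3 , 4) , [ east ]) ∷
  ((3 , 6) , [ south ]) ∷
  ((1 , 6) , [ east ]) ∷
  ((2 , 4) , [ north ]) ∷
  ((3 , 6) , [ west ]) ∷
  ((3 , 8) , [ south ]) ∷
  ((8 , 6) , [ south ]) ∷
  ((0 , 4) , [ east ]) ∷
  ((3 , 4) , [ west ]) ∷
  ((0 , 6) , [ south ]) ∷
  ((3 , 2) , [ north ]) ∷
  ((5 , 2) , [ west ]) ∷
  ((5 , 4) , [ south ]) ∷
  ((3 , 1) , [ north ]) ∷
  ((3 , 4) , [ south ]) ∷
  ((5 , 1) , [ north ]) ∷
  ((8 , 4) , [ west ]) ∷
  ((7 , 6) , south ∷ west ∷ south ∷ []) ∷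
  ((0 , 4) , [ east ]) ∷
  ((1 , 6) , [ south ]) ∷
  ((1 , 4) , [ east ]) ∷
  []

finale : List⁺ Dir
finale = east ∷ south ∷ west ∷ south ∷ south ∷ south ∷ east ∷ north ∷ west ∷ []

afterOpening : ∃[ b ] Moves initial b
afterOpening = from-just (moves? initial opening)

finalSweep : SweepFrom 9 (proj₁ afterOpening) d9
finalSweep = from-just (sweep? (proj₁ afterOpening) d9 finale)

finalBoard : Board
finalBoard = proj₁ (proj₂ finalSweep)

finalBoard-check : SingleManAtInRectangle d3 finalBoard
finalBoard-check = from-yes (singleManAtInRectangle? d3 finalBoard)

mainTheorem3 : ∃[ b ] ∃[ b' ] ∃[ X ] ∃[ Z ]
                 (Moves initial b × Sweep 9 b X Z b' × SingleManAt d3 b')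
mainTheorem3 =
  let b , openingMoves = afterOpening
      Z , b′ , sweep = finalSweep
      supported = sweep-supported sweep (moves-supported openingMoves initial-supported)
  in b , b′ , d9 , Z , openingMoves , sweep ,
     singleManAt-fromRectangle supported _ finalBoard-check
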